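{- Let $\lambda=(\lambda_1\le\cdots\le\lambda_n)$ be a partition with $\lambda_i\ge i$ for all $i$. The rook poset $P_\lambda$ has a maximum element $\hat{1}$, obtained by placing the rooks row by row from the bottom, each as far to the right as possible, i.e. $\hat{1}_i=\max\big(\{1,\dots,\lambda_i\}\setminus\{\hat{1}_1,\dots,\hat{1}_{i-1}\}\big)$, and a minimum element $\hat{0}$ given by $\hat{0}_i=i$ for all $i$.
   Context: A maximal rook placement on the Ferrers board of $\lambda$ (cells $(i,j)$, $1\le j\le\lambda_i$, rows counted from the bottom) is a sequence $x=(x_1,\dots,x_n)$ of distinct integers with $1\le x_i\le\lambda_i$. The rook poset $P_\lambda$ is the set of maximal rook placements with $x\le y$ iff for every $j$, the increasingly sorted list of $\{x_1,\dots,x_j\}$ is entrywise $\le$ that of $\{y_1,\dots,y_j\}$. -}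

module Defs where

open import Data.Nat using (ℕ; zero; suc; _≤_; _≟_)
open import Data.Nat.Properties using (≤-decTotalOrder)
open import Data.Fin using (Fin; toℕ)
open import Data.List using (List; []; _∷_; length; lookup; take; map; upTo; _++_)
open import Data.List.Membership.DecPropositional _≟_ using (_∈?_)
open import Data.List.Relation.Unary.Linked using (Linked)
open import Data.List.Relation.Unary.Unique.Propositional using (Unique)
open import Data.List.Relation.Binary.Pointwise using (Pointwise)
open import Data.Product using (_×_)
open import Relation.Nullary using (does)
open import Data.Bool using (if_then_else_)
import Data.List.Sort.InsertionSort ≤-decTotalOrder as Sort

-- A partition λ = (λ₁ ≤ ⋯ ≤ λₙ), stored as the list [λ₁, …, λₙ]
-- (row 1 = bottom row = head of the list).
IsPartition : List ℕ → Set
IsPartition lam = Linked _≤_ lam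

-- λᵢ ≥ i for all i (1-indexed; list index i is 0-based, so suc i).
Staircase : List ℕ → Set
Staircase lam = (i : Fin (length lam)) → suc (toℕ i) ≤ lookup lam i

-- x is a maximal rook placement on the Ferrers board of λ:
-- length n, 1 ≤ xᵢ ≤ λᵢ, and the xᵢ pairwise distinct.
IsRook : List ℕ → List ℕ → Set
IsRook lam x = Pointwise (λ a l → (1 ≤ a) × (a ≤ l)) x lam × Unique x

sortInc : List ℕ → List ℕ
sortInc = Sort.sort

_≤R_ : List ℕ → List ℕ → Set
x ≤R y = (j : ℕ) → Pointwise _≤_ (sortInc (take j x)) (sortInc (take j y))

-- max ({1,…,k} \ used)  (0 if empty)
maxAvail : ℕ → List ℕ → ℕ
maxAvail zero used = 0
maxAvail (suc k) used = if does (suc k ∈? used) then maxAvail k used else suc k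

hat1Aux : List ℕ → List ℕ → List ℕ
hat1Aux used [] = []
hat1Aux used (l ∷ ls) = maxAvail l used ∷ hat1Aux (maxAvail l used ∷ used) ls

hat1 : List ℕ → List ℕ
hat1 lam = hat1Aux [] lam

hat0 : List ℕ → List ℕ
hat0 lam = map suc (upTo (length lam))

{-# OPTIONS --safe #-}
-- Two lists of equal length have entrywise comparable increasing sortings as soon as, for
-- every threshold t, the first has at most as many entries above t as the second; so it
-- suffices to compare such counts on every prefix. Against 1̂ this is kept row by row: for t
-- below the greedy column 1̂ gains an entry above t, and for t at or above it every column of
-- (t, λᵢ] is already used by 1̂, which therefore has as many entries above t as any set of
-- distinct columns ≤ λᵢ. Against 0̂ the j-th prefix is {1, …, j}, and any j distinct positive
-- integers have at least j ∸ t entries above t.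
module Submission where

open import Defs
open import Data.Nat using (ℕ; zero; suc; _+_; _∸_; _≤_; _<_; _≮_; _⊓_; z≤n; s≤s; s≤s⁻¹; _<?_; _≤?_; _≟_)
open import Data.Nat.Properties
open import Data.Fin using (Fin; toℕ)
import Data.Fin as Fin
open import Data.List using (List; []; _∷_; _++_; _ʳ++_; length; lookup; take; filter; applyUpTo; reverse)
open import Data.List.Properties using (filter-accept; filter-reject; filter-all; length-filter; length-++; length-take; length-applyUpTo; lookup-applyUpTo; map-upTo)
open import Data.List.Membership.Propositional using (_∈_; _∉_)
open import Data.List.Membership.Propositional.Properties using (∈-∃++; ∈-++⁺ˡ; ∈-++⁺ʳ; ∈-filter⁺; ∈-filter⁻; ∈-applyUpTo⁺; ∈-applyUpTo⁻)
open import Data.List.Membership.DecPropositional _≟_ using (_∈?_)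
open import Data.List.Relation.Unary.Any using (here; there)
open import Data.List.Relation.Unary.All as All using (All; []; _∷_)
open import Data.List.Relation.Unary.All.Properties using (¬Any⇒All¬; take⁺)
open import Data.List.Relation.Unary.AllPairs using ([]; _∷_)
open import Data.List.Relation.Unary.Unique.Propositional using (Unique)
import Data.List.Relation.Unary.Unique.Propositional.Properties as Unique
open import Data.List.Relation.Unary.Linked as Linked using (Linked; [-]; _∷_)
open import Data.List.Relation.Unary.Linked.Properties using (Linked⇒All)
open import Data.List.Relation.Binary.Pointwise as Pointwise using (Pointwise; []; _∷_; Pointwise-length)
open import Data.List.Relation.Binary.Subset.Propositional using (_⊆_)
open import Data.List.Relation.Binary.Permutation.Propositional using (_↭_; ↭-sym; ↭⇒↭ₛ)
open import Data.List.Relation.Binary.Permutation.Propositional.Properties using (↭-length; ↭-reverse; shift; ∈-resp-↭; filter-↭)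
import Data.List.Relation.Binary.Permutation.Setoid.Properties as PermutationSetoid
import Data.List.Sort.InsertionSort.Properties ≤-decTotalOrder as Sort
open import Data.Product using (_×_; _,_; proj₂)
open import Function using (_∘′_)
open import Relation.Nullary using (¬_; yes; no; contradiction)
open import Relation.Binary.PropositionalEquality using (_≡_; _≢_; refl; sym; trans; cong; subst; subst₂; setoid; module ≡-Reasoning)
open import Level using (Level)

private
  variable
    a : Level
    A : Set a

Unique-resp-↭ : {xs ys : List A} → xs ↭ ys → Unique xs → Unique ys
Unique-resp-↭ {A = A} xs↭ys = PermutationSetoid.Unique-resp-↭ (setoid A) (↭⇒↭ₛ xs↭ys)

unique-ʳ++⁻ : ∀ (xs : List A) {ys} → Unique (xs ʳ++ ys) → Unique ys
unique-ʳ++⁻ []       uniq = uniq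
unique-ʳ++⁻ (x ∷ xs) uniq with _ ∷ uniq′ ← unique-ʳ++⁻ xs uniq = uniq′

unique-⊆⇒length≤ : {xs ys : List A} → Unique xs → xs ⊆ ys → length xs ≤ length ys
unique-⊆⇒length≤ {xs = []} _ _ = z≤n
unique-⊆⇒length≤ {xs = x ∷ xs} (x∉xs ∷ uniq) x∷xs⊆ys
  with pre , post , refl ← ∈-∃++ (x∷xs⊆ys (here refl)) =
  subst (suc (length xs) ≤_) (sym (↭-length (shift x pre post)))
    (s≤s (unique-⊆⇒length≤ uniq xs⊆pre++post))
  where
  xs⊆pre++post : xs ⊆ pre ++ post
  xs⊆pre++post z∈xs with ∈-resp-↭ (shift x pre post) (x∷xs⊆ys (there z∈xs))
  ... | here refl = contradiction refl (All.lookup x∉xs z∈xs)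
  ... | there z∈  = z∈

take-applyUpTo : ∀ (f : ℕ → A) j n → take j (applyUpTo f n) ≡ applyUpTo f (j ⊓ n)
take-applyUpTo f zero    n       = refl
take-applyUpTo f (suc j) zero    = refl
take-applyUpTo f (suc j) (suc n) = cong (f 0 ∷_) (take-applyUpTo (λ i → f (suc i)) j n)

interval : ℕ → ℕ → List ℕ
interval k n = applyUpTo (λ i → suc (k + i)) n

length-interval : ∀ k n → length (interval k n) ≡ n
length-interval k = length-applyUpTo (λ i → suc (k + i))

∈-interval⁻ : ∀ {k n v} → v ∈ interval k n → k < v × v ≤ k + n
∈-interval⁻ {k} v∈ with i , i<n , refl ← ∈-applyUpTo⁻ (λ i → suc (k + i)) v∈ =
  s≤s (m≤m+n k i) , +-monoʳ-< k i<n

∈-interval⁺ : ∀ {k n v} → k < v → v ≤ k + n → v ∈ interval k n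
∈-interval⁺ {k} {n} {v} k<v v≤k+n =
  subst (_∈ interval k n) k+1+i≡v (∈-applyUpTo⁺ (λ i → suc (k + i)) i<n)
  where
  i : ℕ
  i = v ∸ suc k
  k+1+i≡v : suc (k + i) ≡ v
  k+1+i≡v = m+[n∸m]≡n k<v
  i<n : i < n
  i<n = +-cancelˡ-< k i n (subst (_≤ k + n) (sym k+1+i≡v) v≤k+n)

interval-unique : ∀ k n → Unique (interval k n)
interval-unique k n = Unique.applyUpTo⁺₁ (λ i → suc (k + i)) n
  (λ i<j _ → <⇒≢ (+-monoʳ-< k i<j) ∘′ suc-injective)

length≤∸ : ∀ {xs k l} → Unique xs → (∀ {v} → v ∈ xs → k < v × v ≤ l) → length xs ≤ l ∸ k
length≤∸ {xs} {k} {l} uniq bounded =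
  subst (length xs ≤_) (length-interval k (l ∸ k)) (unique-⊆⇒length≤ uniq xs⊆interval)
  where
  xs⊆interval : xs ⊆ interval k (l ∸ k)
  xs⊆interval v∈ with k<v , v≤l ← bounded v∈ = ∈-interval⁺ k<v (≤-trans v≤l (m≤n+m∸n l k))

∸≤length : ∀ {xs k l} → (∀ {v} → k < v → v ≤ l → v ∈ xs) → l ∸ k ≤ length xs
∸≤length {xs} {k} {l} covered =
  subst (_≤ length xs) (length-interval k (l ∸ k))
    (unique-⊆⇒length≤ (interval-unique k (l ∸ k)) interval⊆xs)
  where
  interval⊆xs : interval k (l ∸ k) ⊆ xs
  interval⊆xs v∈ with k<v , v≤k+[l∸k] ← ∈-interval⁻ v∈ with k ≤? l
  ... | yes k≤l = covered k<v (subst (_ ≤_) (m+[n∸m]≡n k≤l) v≤k+[l∸k])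
  ... | no  k≰l = contradiction (subst (_ ≤_) (k+[l∸k]≡k k≰l) v≤k+[l∸k]) (<⇒≱ k<v)
    where
    k+[l∸k]≡k : ¬ k ≤ l → k + (l ∸ k) ≡ k
    k+[l∸k]≡k k≰l = trans (cong (k +_) (m≤n⇒m∸n≡0 (≰⇒≥ k≰l))) (+-identityʳ k)

countAbove : ℕ → List ℕ → ℕ
countAbove t xs = length (filter (t <?_) xs)

countAbove-accept : ∀ {t x} xs → t < x → countAbove t (x ∷ xs) ≡ suc (countAbove t xs)
countAbove-accept {t} _ t<x = cong length (filter-accept (t <?_) t<x)

countAbove-reject : ∀ {t x} xs → t ≮ x → countAbove t (x ∷ xs) ≡ countAbove t xs
countAbove-reject {t} _ t≮x = cong length (filter-reject (t <?_) t≮x)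

countAbove-∷≤ : ∀ t x xs → countAbove t (x ∷ xs) ≤ suc (countAbove t xs)
countAbove-∷≤ t x xs with t <? x
... | yes t<x = ≤-reflexive (countAbove-accept xs t<x)
... | no  t≮x = m≤n⇒m≤1+n (≤-reflexive (countAbove-reject xs t≮x))

countAbove≤length : ∀ t xs → countAbove t xs ≤ length xs
countAbove≤length t = length-filter (t <?_)

countAbove-all : ∀ {t xs} → All (t <_) xs → countAbove t xs ≡ length xs
countAbove-all {t} t<xs = cong length (filter-all (t <?_) t<xs)

countAbove-↭ : ∀ t {xs ys} → xs ↭ ys → countAbove t xs ≡ countAbove t ys
countAbove-↭ t xs↭ys = ↭-length (filter-↭ (t <?_) xs↭ys)

countAbove≤∸ : ∀ {t l xs} → Unique xs → All (_≤ l) xs → countAbove t xs ≤ l ∸ t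
countAbove≤∸ {t} {l} {xs} uniq xs≤l = length≤∸ (Unique.filter⁺ (t <?_) uniq) bounded
  where
  bounded : ∀ {v} → v ∈ filter (t <?_) xs → t < v × v ≤ l
  bounded v∈ with v∈xs , t<v ← ∈-filter⁻ (t <?_) v∈ = t<v , All.lookup xs≤l v∈xs

∸≤countAbove : ∀ {t l xs} → (∀ {v} → t < v → v ≤ l → v ∈ xs) → l ∸ t ≤ countAbove t xs
∸≤countAbove {t} covered = ∸≤length (λ t<v v≤l → ∈-filter⁺ (t <?_) (covered t<v v≤l) t<v)

length∸≤countAbove : ∀ {t xs} → Unique xs → All (0 <_) xs → length xs ∸ t ≤ countAbove t xs
length∸≤countAbove {t} {xs} uniq positive =
  m≤n+o⇒m∸n≤o (length xs) t (begin
    length xs                                     ≤⟨ unique-⊆⇒length≤ uniq xs⊆ ⟩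
    length (interval 0 t ++ filter (t <?_) xs)    ≡⟨ length-++ (interval 0 t) ⟩
    length (interval 0 t) + countAbove t xs       ≡⟨ cong (_+ countAbove t xs) (length-interval 0 t) ⟩
    t + countAbove t xs                           ∎)
  where
  open ≤-Reasoning
  xs⊆ : xs ⊆ interval 0 t ++ filter (t <?_) xs
  xs⊆ {v} v∈xs with t <? v
  ... | yes t<v = ∈-++⁺ʳ (interval 0 t) (∈-filter⁺ (t <?_) v∈xs t<v)
  ... | no  t≮v = ∈-++⁺ˡ (∈-interval⁺ (All.lookup positive v∈xs) (≮⇒≥ t≮v))

infix 4 _≼_

_≼_ : List ℕ → List ℕ → Set
xs ≼ ys = ∀ t → countAbove t xs ≤ countAbove t ys

≼-resp-↭ : ∀ {xs xs′ ys ys′} → xs ↭ xs′ → ys ↭ ys′ → xs ≼ ys → xs′ ≼ ys′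
≼-resp-↭ xs↭xs′ ys↭ys′ xs≼ys t =
  subst₂ _≤_ (countAbove-↭ t xs↭xs′) (countAbove-↭ t ys↭ys′) (xs≼ys t)

interval-≼ : ∀ {xs} → Unique xs → All (0 <_) xs → interval 0 (length xs) ≼ xs
interval-≼ {xs} uniq positive t = begin
  countAbove t (interval 0 (length xs))  ≤⟨ countAbove≤∸ (interval-unique 0 (length xs)) bounded ⟩
  length xs ∸ t                          ≤⟨ length∸≤countAbove uniq positive ⟩
  countAbove t xs                        ∎
  where
  open ≤-Reasoning
  bounded : All (_≤ length xs) (interval 0 (length xs))
  bounded = All.tabulate (λ v∈ → proj₂ (∈-interval⁻ v∈))

sorted-≼⇒pointwise-≤ : ∀ {xs ys} → Linked _≤_ xs → Linked _≤_ ys →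
  length xs ≡ length ys → xs ≼ ys → Pointwise _≤_ xs ys
sorted-≼⇒pointwise-≤ {[]}     {[]}     _   _   _  _  = []
sorted-≼⇒pointwise-≤ {x ∷ xs} {y ∷ ys} ↗xs ↗ys eq xs≼ys =
  x≤y ∷ sorted-≼⇒pointwise-≤ (Linked.tail ↗xs) (Linked.tail ↗ys) (suc-injective eq) tail≼
  where
  open ≤-Reasoning

  above : ∀ {t z zs} → t < z → Linked _≤_ (z ∷ zs) → All (t <_) (z ∷ zs)
  above t<z ↗zs = All.map (<-≤-trans t<z) (Linked⇒All ≤-trans ≤-refl ↗zs)

  x≤y : x ≤ y
  x≤y with x ≤? y
  ... | yes x≤y = x≤y
  ... | no  x≰y = contradiction (xs≼ys y) (<⇒≱ (begin-strict
    countAbove y (y ∷ ys)  ≡⟨ countAbove-reject ys (n≮n y) ⟩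
    countAbove y ys        ≤⟨ countAbove≤length y ys ⟩
    length ys              ≡⟨ suc-injective eq ⟨
    length xs              <⟨ n<1+n (length xs) ⟩
    length (x ∷ xs)        ≡⟨ countAbove-all (above (≰⇒> x≰y) ↗xs) ⟨
    countAbove y (x ∷ xs)  ∎))

  tail≼ : xs ≼ ys
  tail≼ t with t <? y
  ... | yes t<y = begin
    countAbove t xs  ≤⟨ countAbove≤length t xs ⟩
    length xs        ≡⟨ suc-injective eq ⟩
    length ys        ≡⟨ countAbove-all (All.tail (above t<y ↗ys)) ⟨
    countAbove t ys  ∎
  ... | no  t≮y = begin
    countAbove t xs        ≡⟨ countAbove-reject xs (λ t<x → t≮y (<-≤-trans t<x x≤y)) ⟨
    countAbove t (x ∷ xs)  ≤⟨ xs≼ys t ⟩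
    countAbove t (y ∷ ys)  ≡⟨ countAbove-reject ys t≮y ⟩
    countAbove t ys        ∎

≼⇒≤R : ∀ {x y} → length x ≡ length y → (∀ j → take j x ≼ take j y) → x ≤R y
≼⇒≤R {x} {y} |x|≡|y| prefix≼ j =
  sorted-≼⇒pointwise-≤ (Sort.sort-↗ (take j x)) (Sort.sort-↗ (take j y)) sorted-lengths
    (≼-resp-↭ (↭-sym (Sort.sort-↭ (take j x))) (↭-sym (Sort.sort-↭ (take j y))) (prefix≼ j))
  where
  open ≡-Reasoning
  sorted-lengths : length (sortInc (take j x)) ≡ length (sortInc (take j y))
  sorted-lengths = begin
    length (sortInc (take j x))  ≡⟨ ↭-length (Sort.sort-↭ (take j x)) ⟩
    length (take j x)            ≡⟨ length-take j x ⟩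
    j ⊓ length x                 ≡⟨ cong (j ⊓_) |x|≡|y| ⟩
    j ⊓ length y                 ≡⟨ length-take j y ⟨
    length (take j y)            ≡⟨ ↭-length (Sort.sort-↭ (take j y)) ⟨
    length (sortInc (take j y))  ∎

maxAvail≤ : ∀ l U → maxAvail l U ≤ l
maxAvail≤ zero    U = z≤n
maxAvail≤ (suc k) U with suc k ∈? U
... | yes _ = m≤n⇒m≤1+n (maxAvail≤ k U)
... | no  _ = ≤-refl

maxAvail-maximal : ∀ {l U v} → maxAvail l U < v → v ≤ l → v ∈ U
maxAvail-maximal {zero}  m<v v≤0 = contradiction (<-≤-trans m<v v≤0) (λ ())
maxAvail-maximal {suc k} {U} {v} m<v v≤l with suc k ∈? U
... | no  _ = contradiction v≤l (<⇒≱ m<v)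
... | yes k+1∈U with v ≟ suc k
...   | yes refl = k+1∈U
...   | no  v≢k+1 = maxAvail-maximal {k} m<v (s≤s⁻¹ (≤∧≢⇒< v≤l v≢k+1))

maxAvail∉ : ∀ {l U} → 0 < maxAvail l U → maxAvail l U ∉ U
maxAvail∉ {suc k} {U} 0<m with suc k ∈? U
... | yes _     = maxAvail∉ {k} 0<m
... | no  k+1∉U = k+1∉U

maxAvail-positive : ∀ {l U} → length U < l → 0 < maxAvail l U
maxAvail-positive {l} {U} |U|<l with 0 <? maxAvail l U
... | yes 0<m = 0<m
... | no  0≮m = contradiction (∸≤length {U} {0} {l} columns-used) (<⇒≱ |U|<l)
  where
  columns-used : ∀ {v} → 0 < v → v ≤ l → v ∈ U
  columns-used 0<v = maxAvail-maximal (≤-<-trans (≮⇒≥ 0≮m) 0<v)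

maxAvail-∷-≼ : ∀ {l U y P} → y ≤ l → All (_≤ l) P → Unique (y ∷ P) → P ≼ U →
  y ∷ P ≼ maxAvail l U ∷ U
maxAvail-∷-≼ {l} {U} {y} {P} y≤l P≤l uniq P≼U t with t <? maxAvail l U
... | yes t<m = begin
  countAbove t (y ∷ P)               ≤⟨ countAbove-∷≤ t y P ⟩
  suc (countAbove t P)               ≤⟨ s≤s (P≼U t) ⟩
  suc (countAbove t U)               ≡⟨ countAbove-accept U t<m ⟨
  countAbove t (maxAvail l U ∷ U)    ∎
  where open ≤-Reasoning
... | no  t≮m = begin
  countAbove t (y ∷ P)               ≤⟨ countAbove≤∸ uniq (y≤l ∷ P≤l) ⟩
  l ∸ t                              ≤⟨ ∸≤countAbove (λ t<v → maxAvail-maximal (≤-<-trans (≮⇒≥ t≮m) t<v)) ⟩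
  countAbove t U                     ≡⟨ countAbove-reject U t≮m ⟨
  countAbove t (maxAvail l U ∷ U)    ∎
  where open ≤-Reasoning

InRow : ℕ → ℕ → Set
InRow a l = (1 ≤ a) × (a ≤ l)

inRows⇒positive : ∀ {xs ls} → Pointwise InRow xs ls → All (0 <_) xs
inRows⇒positive []               = []
inRows⇒positive ((0<x , _) ∷ rows) = 0<x ∷ inRows⇒positive rows

StaircaseFrom : ℕ → List ℕ → Set
StaircaseFrom k ls = (i : Fin (length ls)) → suc (k + toℕ i) ≤ lookup ls i

staircase-head : ∀ {k l ls} → StaircaseFrom k (l ∷ ls) → k < l
staircase-head {k} {l} sc = subst (λ m → suc m ≤ l) (+-identityʳ k) (sc Fin.zero)

staircase-tail : ∀ {k l ls} → StaircaseFrom k (l ∷ ls) → StaircaseFrom (suc k) ls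
staircase-tail {k} {ls = ls} sc i = subst (λ m → suc m ≤ lookup ls i) (+-suc k (toℕ i)) (sc (Fin.suc i))

hat1Aux-inRows : ∀ {U ls} → StaircaseFrom (length U) ls → Pointwise InRow (hat1Aux U ls) ls
hat1Aux-inRows {U} {[]}     _  = []
hat1Aux-inRows {U} {l ∷ ls} sc =
  (maxAvail-positive (staircase-head sc) , maxAvail≤ l U) ∷ hat1Aux-inRows (staircase-tail sc)

hat1Aux-unique : ∀ {U ls} → StaircaseFrom (length U) ls → Unique U → Unique (hat1Aux U ls ʳ++ U)
hat1Aux-unique {U} {[]}     _  uniq = uniq
hat1Aux-unique {U} {l ∷ ls} sc uniq =
  hat1Aux-unique {ls = ls} (staircase-tail sc) (m∉U ∷ uniq)
  where
  m∉U : All (maxAvail l U ≢_) U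
  m∉U = ¬Any⇒All¬ U (maxAvail∉ {l} {U} (maxAvail-positive (staircase-head sc)))

-- P and U are the columns already used by y and by 1̂, most recent first; b is the last row length.
prefix-≼-hat1Aux : ∀ {b U P ls ys} → Linked _≤_ (b ∷ ls) → All (_≤ b) P → Unique (ys ʳ++ P) →
  Pointwise InRow ys ls → P ≼ U → ∀ j → take j ys ʳ++ P ≼ take j (hat1Aux U ls) ʳ++ U
prefix-≼-hat1Aux _ _ _ _ P≼U zero = P≼U
prefix-≼-hat1Aux _ _ _ [] P≼U (suc j) = P≼U
prefix-≼-hat1Aux {P = P} {l ∷ _} {y ∷ ys} (b≤l ∷ ↗ls) P≤b uniq ((_ , y≤l) ∷ rows) P≼U (suc j) =
  prefix-≼-hat1Aux ↗ls (y≤l ∷ P≤l) uniq rows (maxAvail-∷-≼ y≤l P≤l (unique-ʳ++⁻ ys uniq) P≼U) j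
  where
  P≤l : All (_≤ l) P
  P≤l = All.map (λ p≤b → ≤-trans p≤b b≤l) P≤b

hat1-isRook : ∀ {lam} → Staircase lam → IsRook lam (hat1 lam)
hat1-isRook {lam} sc =
  hat1Aux-inRows {[]} {lam} sc , Unique-resp-↭ (↭-reverse (hat1 lam)) (hat1Aux-unique {[]} {lam} sc [])

hat0≡interval : ∀ lam → hat0 lam ≡ interval 0 (length lam)
hat0≡interval lam = map-upTo suc (length lam)

hat0-isRook : ∀ {lam} → Staircase lam → IsRook lam (hat0 lam)
hat0-isRook {lam} sc rewrite hat0≡interval lam =
  Pointwise.lookup⁻ (length-interval 0 (length lam)) inRow , interval-unique 0 (length lam)
  where
  inRow : ∀ {i j} → toℕ i ≡ toℕ j → InRow (lookup (interval 0 (length lam)) i) (lookup lam j)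
  inRow {i} {j} i≡j rewrite lookup-applyUpTo suc (length lam) i | i≡j = s≤s z≤n , sc j

hat1-isMaximum : ∀ {lam y} → IsPartition lam → Staircase lam → IsRook lam y → y ≤R hat1 lam
hat1-isMaximum {lam} {y} part sc (rows , uniq) =
  ≼⇒≤R (trans (Pointwise-length rows) (sym (Pointwise-length (hat1Aux-inRows {[]} {lam} sc))))
    (λ j → ≼-resp-↭ (↭-reverse (take j y)) (↭-reverse (take j (hat1 lam))) (reversed-prefix-≼ j))
  where
  0∷-linked : ∀ {ls} → Linked _≤_ ls → Linked _≤_ (0 ∷ ls)
  0∷-linked {[]}    _   = [-]
  0∷-linked {_ ∷ _} ↗ls = z≤n ∷ ↗ls

  reversed-prefix-≼ : ∀ j → reverse (take j y) ≼ reverse (take j (hat1 lam))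
  reversed-prefix-≼ =
    prefix-≼-hat1Aux (0∷-linked part) [] (Unique-resp-↭ (↭-sym (↭-reverse y)) uniq) rows (λ _ → z≤n)

hat0-isMinimum : ∀ {lam y} → IsRook lam y → hat0 lam ≤R y
hat0-isMinimum {lam} {y} (rows , uniq) =
  ≼⇒≤R |hat0|≡|y| λ j →
    subst (_≼ take j y) (sym (prefix j)) (interval-≼ (Unique.take⁺ j uniq) (take⁺ j (inRows⇒positive rows)))
  where
  n : ℕ
  n = length lam
  open ≡-Reasoning
  |hat0|≡|y| : length (hat0 lam) ≡ length y
  |hat0|≡|y| = begin
    length (hat0 lam)      ≡⟨ cong length (hat0≡interval lam) ⟩
    length (interval 0 n)  ≡⟨ length-interval 0 n ⟩
    n                      ≡⟨ Pointwise-length rows ⟨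
    length y               ∎
  prefix : ∀ j → take j (hat0 lam) ≡ interval 0 (length (take j y))
  prefix j = begin
    take j (hat0 lam)              ≡⟨ cong (take j) (hat0≡interval lam) ⟩
    take j (interval 0 n)          ≡⟨ take-applyUpTo suc j n ⟩
    interval 0 (j ⊓ n)             ≡⟨ cong (λ m → interval 0 (j ⊓ m)) (Pointwise-length rows) ⟨
    interval 0 (j ⊓ length y)      ≡⟨ cong (interval 0) (length-take j y) ⟨
    interval 0 (length (take j y)) ∎

mainTheorem2 : (lam : List ℕ) → IsPartition lam → Staircase lam →
    (IsRook lam (hat1 lam) × IsRook lam (hat0 lam)) ×
    ((y : List ℕ) → IsRook lam y → (y ≤R hat1 lam) × (hat0 lam ≤R y))
mainTheorem2 lam part sc =
  (hat1-isRook sc , hat0-isRook sc) ,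
  λ y rook → hat1-isMaximum part sc rook , hat0-isMinimum rook
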